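{- For every integer $n\ge 3$, $dyn_2(C_n\Box K_n)=\left\lfloor \dfrac{n}{2}+1\right\rfloor$.
   Context: $C_n$ is the cycle and $K_n$ the complete graph on $n$ vertices; $G\Box H$ is the Cartesian product (vertex set $V(G)\times V(H)$, $(u,v)\sim(u',v')$ iff $u=u'$ and $vv'\in E(H)$, or $v=v'$ and $uu'\in E(G)$). For a graph $G$ with threshold assignment $\tau:V(G)\to\mathbb{N}$, a set $D\subseteq V(G)$ is a $\tau$-dynamic monopoly if $V(G)$ can be partitioned into sets $D_0=D,D_1,\dots,D_k$ such that each vertex $v\in D_{i+1}$ has at least $\tau(v)$ neighbors in $D_0\cup\dots\cup D_i$ (equivalently, starting from $D$ and repeatedly adding vertices $u$ having at least $\tau(u)$ neighbors in the current set yields all of $V(G)$). $dyn_\tau(G)$ is the minimum size of a $\tau$-dynamic monopoly, written $dyn_t(G)$ when $\tau\equiv t$. -}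

module Defs where

open import Data.Nat using (ℕ; zero; suc; _+_; _*_; _≤_; _<_; _≡ᵇ_; _<ᵇ_)
open import Data.Nat.Properties using (_≟_)
open import Data.Fin using (Fin; toℕ)
open import Data.Bool using (Bool; true; false; _∧_; _∨_; not; if_then_else_)
open import Data.Product using (_×_; _,_; Σ; proj₁; proj₂)
open import Data.List using (List; allFin; filter; length; cartesianProduct)
open import Relation.Nullary.Decidable using (⌊_⌋)

record Graph : Set where
  field
    order : ℕ
    adj   : Fin order → Fin order → Bool

-- Cycle C_n on vertices 0..n-1: i ~ j iff j ≡ i+1 or i ≡ j+1 (mod n).  (n ≥ 3 intended)
cycAdj : (n : ℕ) → Fin n → Fin n → Bool
cycAdj n i j = succ i j ∨ succ j i
  where
  succ : Fin n → Fin n → Bool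
  succ a b = (suc (toℕ a) ≡ᵇ toℕ b) ∨ ((suc (toℕ a) ≡ᵇ n) ∧ (toℕ b ≡ᵇ 0))

compAdj : (n : ℕ) → Fin n → Fin n → Bool
compAdj n i j = not (toℕ i ≡ᵇ toℕ j)

V : ℕ → Set
V n = Fin n × Fin n

eqF : {n : ℕ} → Fin n → Fin n → Bool
eqF i j = toℕ i ≡ᵇ toℕ j

prodAdj : (n : ℕ) → V n → V n → Bool
prodAdj n (u , v) (u' , v') =
  (eqF u u' ∧ compAdj n v v') ∨ (eqF v v' ∧ cycAdj n u u')

allV : (n : ℕ) → List (V n)
allV n = cartesianProduct (allFin n) (allFin n)

size : (n : ℕ) → (V n → Bool) → ℕ
size n D = length (filter (λ x → D x ≡ᵇ' true) (allV n))
  where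
  open import Relation.Nullary using (Dec; yes; no)
  open import Relation.Binary.PropositionalEquality using (_≡_)
  open import Data.Bool.Properties renaming (_≟_ to _≟b_)
  _≡ᵇ'_ : (a b : Bool) → Dec (a ≡ b)
  _≡ᵇ'_ = _≟b_

-- A τ-dynamic monopoly, with τ ≡ t, in C_n □ K_n: a partition D₀ = D, D₁, …, D_k of the
-- vertex set, encoded by the index function  lvl : V → ℕ  (lvl x = i iff x ∈ D_i), such that
-- every vertex in D_{i+1} has at least t neighbours in D₀ ∪ … ∪ D_i.
module _ where
  open import Relation.Binary.PropositionalEquality using (_≡_)
  open import Relation.Nullary using (Dec; yes; no)
  open import Data.Bool.Properties renaming (_≟_ to _≟b_)

  earlierNbrs : (n : ℕ) → (V n → ℕ) → V n → ℕ → ℕ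
  earlierNbrs n lvl x i =
    length (filter (λ y → (prodAdj n y x ∧ (lvl y <ᵇ i)) ≟b true) (allV n))

  IsDynMonopoly : (n t : ℕ) → (V n → Bool) → Set
  IsDynMonopoly n t D =
    Σ (V n → ℕ) λ lvl →
      ((x : V n) → (D x ≡ true → lvl x ≡ 0) × (lvl x ≡ 0 → D x ≡ true))
      × ((x : V n) (i : ℕ) → lvl x ≡ suc i → t ≤ earlierNbrs n lvl x (suc i))

  DynEq : (n t m : ℕ) → Set
  DynEq n t m =
    (Σ (V n → Bool) λ D → IsDynMonopoly n t D × size n D ≡ m)
    × ((D : V n → Bool) → IsDynMonopoly n t D → m ≤ size n D)

-- Call {u} × K_n the layer of the cycle vertex u and let s(u) be the number of seeds in it.
-- Outside its layer a vertex has exactly two neighbours: the vertices of its column in the two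
-- adjacent layers.  Hence two consecutive seedless layers are never infected, since each of their
-- vertices has a single neighbour outside them.  If instead every two consecutive layers held at
-- most one seed, the infected set would stay sparse (at most one vertex per layer, in a common
-- column for adjacent layers) and could never fill a layer.  So s(u) + s(u + 1) ≥ 1 for all u,
-- with ≥ 2 somewhere, and summing over the cycle gives 2|D| ≥ n + 1.

module Submission where

open import Defs
open import Data.Nat using (ℕ; zero; suc; _≤_; _<_; _+_; _*_; _/_; z≤n; s≤s; _≡ᵇ_; _<ᵇ_; _≤?_; _<?_)
open import Data.Nat.Properties
open import Data.Nat.DivMod using (_mod_; m%n<n; m<n⇒m%n≡m; n%n≡0; m/n≡1+[m∸n]/n; m<n*o⇒m/o<n)
open import Data.Nat.ListAction using (sum)
open import Data.Fin using (Fin; toℕ; inject₁) renaming (zero to fzero; suc to fsuc)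
open import Data.Fin.Properties using (toℕ-injective; toℕ-fromℕ<; toℕ<n; toℕ-inject₁; ¬∀⟶∃¬) renaming (_≟_ to _≟ᶠ_)
open import Data.Bool using (Bool; true; false; _∧_; _∨_; not; if_then_else_)
open import Data.Bool.Properties using (T-≡) renaming (_≟_ to _≟ᵇ_)
open import Data.List using (List; []; _∷_; _++_; map; filter; length; allFin; tabulate; cartesianProduct)
open import Data.List.Properties using (map-tabulate)
open import Data.List.Membership.Propositional using (_∈_)
open import Data.List.Membership.Propositional.Properties using (∈-cartesianProduct⁺; ∈-allFin)
open import Data.List.Relation.Unary.Any using (here; there)
open import Data.List.Relation.Unary.All using (lookup)
open import Data.List.Relation.Unary.AllPairs using (_∷_)
open import Data.List.Relation.Unary.Unique.Propositional using (Unique)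
open import Data.List.Relation.Unary.Unique.Propositional.Properties using (cartesianProduct⁺; allFin⁺)
open import Data.Product using (∃; _×_; _,_; proj₁; proj₂)
open import Data.Sum using (_⊎_; inj₁; inj₂; swap)
open import Data.Empty using (⊥; ⊥-elim)
open import Function using (_∘_; Equivalence)
open import Relation.Binary.PropositionalEquality
open import Relation.Nullary using (¬_; yes; no)
import Algebra.Properties.CommutativeSemigroup as CommSemigroupProperties

∨-true⁻ : ∀ x {y} → x ∨ y ≡ true → x ≡ true ⊎ y ≡ true
∨-true⁻ true  _ = inj₁ refl
∨-true⁻ false e = inj₂ e

∨-trueˡ : ∀ {x} y → x ≡ true → x ∨ y ≡ true
∨-trueˡ _ refl = refl

∨-trueʳ : ∀ x {y} → y ≡ true → x ∨ y ≡ true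
∨-trueʳ true  _ = refl
∨-trueʳ false e = e

∧-true⁻ : ∀ x {y} → x ∧ y ≡ true → x ≡ true × y ≡ true
∧-true⁻ true e = refl , e

∧-true : ∀ {x y} → x ≡ true → y ≡ true → x ∧ y ≡ true
∧-true refl refl = refl

≡ᵇ-true⁻ : ∀ {m n} → (m ≡ᵇ n) ≡ true → m ≡ n
≡ᵇ-true⁻ {m} {n} e = ≡ᵇ⇒≡ m n (Equivalence.from T-≡ e)

≡ᵇ-true : ∀ {m n} → m ≡ n → (m ≡ᵇ n) ≡ true
≡ᵇ-true {m} {n} e = Equivalence.to T-≡ (≡⇒≡ᵇ m n e)

≡ᵇ-false : ∀ {m n} → m ≢ n → (m ≡ᵇ n) ≡ false
≡ᵇ-false {m} {n} m≢n with m ≡ᵇ n in e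
... | true  = ⊥-elim (m≢n (≡ᵇ-true⁻ e))
... | false = refl

<ᵇ-true⁻ : ∀ {m n} → (m <ᵇ n) ≡ true → m < n
<ᵇ-true⁻ {m} {n} e = <ᵇ⇒< m n (Equivalence.from T-≡ e)

<ᵇ-true : ∀ {m n} → m < n → (m <ᵇ n) ≡ true
<ᵇ-true m<n = Equivalence.to T-≡ (<⇒<ᵇ m<n)

2≰1 : ∀ {c} → 2 ≤ c → c ≤ 1 → ⊥
2≰1 2≤c c≤1 with ≤-trans 2≤c c≤1
... | s≤s ()

count : {A : Set} → (A → Bool) → List A → ℕ
count p xs = length (filter (λ x → p x ≟ᵇ true) xs)

indicator : Bool → ℕ
indicator true  = 1
indicator false = 0

module _ {A : Set} (p : A → Bool) where

  count≡sum : ∀ xs → count p xs ≡ sum (map (indicator ∘ p) xs)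
  count≡sum [] = refl
  count≡sum (x ∷ xs) with p x
  ... | true  = cong suc (count≡sum xs)
  ... | false = count≡sum xs

  count-++ : ∀ xs ys → count p (xs ++ ys) ≡ count p xs + count p ys
  count-++ [] ys = refl
  count-++ (x ∷ xs) ys with p x
  ... | true  = cong suc (count-++ xs ys)
  ... | false = count-++ xs ys

  count≡0 : ∀ xs → (∀ {x} → x ∈ xs → p x ≢ true) → count p xs ≡ 0
  count≡0 [] _ = refl
  count≡0 (x ∷ xs) none with p x in e
  ... | true  = ⊥-elim (none (here refl) e)
  ... | false = count≡0 xs (none ∘ there)

  count≤1 : ∀ {xs} → Unique xs →
            (∀ {x y} → x ∈ xs → y ∈ xs → p x ≡ true → p y ≡ true → x ≡ y) → count p xs ≤ 1
  count≤1 {[]} _ _ = z≤n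
  count≤1 {x ∷ xs} (x∉xs ∷ unique) same with p x in e
  ... | true  = s≤s (≤-reflexive (count≡0 xs λ y∈xs py →
                  lookup x∉xs y∈xs (same (here refl) (there y∈xs) e py)))
  ... | false = count≤1 unique λ x∈ y∈ → same (there x∈) (there y∈)

  count≥1 : ∀ {x xs} → x ∈ xs → p x ≡ true → 1 ≤ count p xs
  count≥1 {xs = y ∷ _} (here refl) px rewrite px = s≤s z≤n
  count≥1 {xs = y ∷ _} (there x∈) px with p y
  ... | true  = s≤s z≤n
  ... | false = count≥1 x∈ px

  count≥2 : ∀ {x y xs} → x ≢ y → x ∈ xs → y ∈ xs → p x ≡ true → p y ≡ true → 2 ≤ count p xs
  count≥2 x≢y (here refl) (here refl) _ _ = ⊥-elim (x≢y refl)
  count≥2 _ (here refl) (there y∈) px py rewrite px = s≤s (count≥1 y∈ py)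
  count≥2 _ (there x∈) (here refl) px py rewrite py = s≤s (count≥1 x∈ px)
  count≥2 {xs = z ∷ _} x≢y (there x∈) (there y∈) px py with p z
  ... | true  = s≤s (count≥1 x∈ px)
  ... | false = count≥2 x≢y x∈ y∈ px py

count-map : {A B : Set} (p : B → Bool) (f : A → B) (xs : List A) → count p (map f xs) ≡ count (p ∘ f) xs
count-map p f [] = refl
count-map p f (x ∷ xs) with p (f x)
... | true  = cong suc (count-map p f xs)
... | false = count-map p f xs

count-cartesianProduct : {A B : Set} (p : A × B → Bool) (xs : List A) (ys : List B) →
  count p (cartesianProduct xs ys) ≡ sum (map (λ x → count (λ y → p (x , y)) ys) xs)
count-cartesianProduct p [] ys = refl
count-cartesianProduct p (x ∷ xs) ys = begin
  count p (map (x ,_) ys ++ cartesianProduct xs ys)      ≡⟨ count-++ p (map (x ,_) ys) _ ⟩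
  count p (map (x ,_) ys) + count p (cartesianProduct xs ys)
    ≡⟨ cong₂ _+_ (count-map p (x ,_) ys) (count-cartesianProduct p xs ys) ⟩
  count (λ y → p (x , y)) ys + sum (map (λ x → count (λ y → p (x , y)) ys) xs) ∎
  where open ≡-Reasoning

sumBelow : ℕ → (ℕ → ℕ) → ℕ
sumBelow zero    g = 0
sumBelow (suc k) g = g 0 + sumBelow k (g ∘ suc)

syntax sumBelow k (λ j → e) = ∑[ j < k ] e

sum-tabulate : ∀ {k} (f : Fin k → ℕ) (g : ℕ → ℕ) → (∀ i → g (toℕ i) ≡ f i) →
               sum (tabulate f) ≡ ∑[ j < k ] g j
sum-tabulate {zero}  f g g≗f = refl
sum-tabulate {suc k} f g g≗f = cong₂ _+_ (sym (g≗f fzero)) (sum-tabulate (f ∘ fsuc) (g ∘ suc) (g≗f ∘ fsuc))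

sum-map-allFin : ∀ {k} (f : Fin k → ℕ) (g : ℕ → ℕ) → (∀ i → g (toℕ i) ≡ f i) →
                 sum (map f (allFin k)) ≡ ∑[ j < k ] g j
sum-map-allFin {k} f g g≗f = trans (cong sum (map-tabulate (λ i → i) f)) (sum-tabulate f g g≗f)

count-allFin : ∀ k (p : ℕ → Bool) → count (p ∘ toℕ) (allFin k) ≡ ∑[ j < k ] indicator (p j)
count-allFin k p = trans (count≡sum (p ∘ toℕ) (allFin k)) (sum-map-allFin {k} _ (indicator ∘ p) λ _ → refl)

sumBelow-snoc : ∀ k (g : ℕ → ℕ) → ∑[ j < suc k ] g j ≡ ∑[ j < k ] g j + g k
sumBelow-snoc zero    g = +-comm (g 0) 0
sumBelow-snoc (suc k) g = trans (cong (g 0 +_) (sumBelow-snoc k (g ∘ suc))) (sym (+-assoc (g 0) _ _))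

sumBelow-+ : ∀ k (g h : ℕ → ℕ) → ∑[ j < k ] (g j + h j) ≡ ∑[ j < k ] g j + ∑[ j < k ] h j
sumBelow-+ zero    g h = refl
sumBelow-+ (suc k) g h = trans (cong (g 0 + h 0 +_) (sumBelow-+ k (g ∘ suc) (h ∘ suc)))
                               (CommSemigroupProperties.interchange +-commutativeSemigroup (g 0) (h 0) _ _)

sumBelow-≡0 : ∀ k (g : ℕ → ℕ) → (∀ j → g j ≡ 0) → ∑[ j < k ] g j ≡ 0
sumBelow-≡0 zero    g g≡0 = refl
sumBelow-≡0 (suc k) g g≡0 = cong₂ _+_ (g≡0 0) (sumBelow-≡0 k (g ∘ suc) (g≡0 ∘ suc))

sumBelow-rotate : ∀ k (g : ℕ → ℕ) → g k ≡ g 0 → ∑[ j < k ] g (suc j) ≡ ∑[ j < k ] g j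
sumBelow-rotate k g gk≡g0 = +-cancelˡ-≡ (g 0) _ _ (begin
  g 0 + ∑[ j < k ] g (suc j) ≡⟨ sumBelow-snoc k g ⟩
  ∑[ j < k ] g j + g k       ≡⟨ cong (∑[ j < k ] g j +_) gk≡g0 ⟩
  ∑[ j < k ] g j + g 0       ≡⟨ +-comm _ (g 0) ⟩
  g 0 + ∑[ j < k ] g j       ∎)
  where open ≡-Reasoning

k≤sumBelow : ∀ k (g : ℕ → ℕ) → (∀ j → j < k → 1 ≤ g j) → k ≤ ∑[ j < k ] g j
k≤sumBelow zero    g pos = z≤n
k≤sumBelow (suc k) g pos = +-mono-≤ (pos 0 (s≤s z≤n)) (k≤sumBelow k (g ∘ suc) λ j j<k → pos (suc j) (s≤s j<k))

k<sumBelow : ∀ k (g : ℕ → ℕ) j₀ → (∀ j → j < k → 1 ≤ g j) → j₀ < k → 2 ≤ g j₀ → k < ∑[ j < k ] g j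
k<sumBelow (suc k) g zero     pos _ two = +-mono-≤ two (k≤sumBelow k (g ∘ suc) λ j j<k → pos (suc j) (s≤s j<k))
k<sumBelow (suc k) g (suc j₀) pos (s≤s j₀<k) two =
  +-mono-≤ (pos 0 (s≤s z≤n)) (k<sumBelow k (g ∘ suc) j₀ (λ j j<k → pos (suc j) (s≤s j<k)) j₀<k two)

odd : ℕ → Bool
odd zero          = false
odd (suc zero)    = true
odd (suc (suc k)) = odd k

odd-suc≡false⇒odd : ∀ k → odd (suc k) ≡ false → odd k ≡ true
odd-suc≡false⇒odd (suc zero)    _ = refl
odd-suc≡false⇒odd (suc (suc k)) e = odd-suc≡false⇒odd k e

[2+k]/2≡1+k/2 : ∀ k → (2 + k) / 2 ≡ suc (k / 2)
[2+k]/2≡1+k/2 k = m/n≡1+[m∸n]/n {2 + k} {2} (s≤s (s≤s z≤n))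

sumBelow-odd : ∀ k → ∑[ j < k ] indicator (odd j) ≡ k / 2
sumBelow-odd zero          = refl
sumBelow-odd (suc zero)    = refl
sumBelow-odd (suc (suc k)) = trans (cong suc (sumBelow-odd k)) (sym ([2+k]/2≡1+k/2 k))

[n+2]/2≤ : ∀ n s → n < s + s → (n + 2) / 2 ≤ s
[n+2]/2≤ n s n<2s = ≤-pred (m<n*o⇒m/o<n (begin-strict
  n + 2       ≡⟨ +-comm n 2 ⟩
  2 + n       <⟨ +-monoʳ-< 2 n<2s ⟩
  2 + (s + s) ≡⟨ cong (2 +_) (sym (trans (*-comm s 2) (cong (s +_) (+-identityʳ s)))) ⟩
  2 + s * 2   ∎))
  where open ≤-Reasoning

module Cycle (m : ℕ) where

  n : ℕ
  n = suc m

  toℕ-mod : ∀ {j} → j < n → toℕ (j mod n) ≡ j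
  toℕ-mod {j} j<n = trans (toℕ-fromℕ< (m%n<n j n)) (m<n⇒m%n≡m j<n)

  toℕ-n-mod-n : toℕ (n mod n) ≡ 0
  toℕ-n-mod-n = trans (toℕ-fromℕ< (m%n<n n n)) (n%n≡0 n)

  n-mod-n : n mod n ≡ 0 mod n
  n-mod-n = toℕ-injective (trans toℕ-n-mod-n (sym (toℕ-mod (s≤s z≤n))))

  mod-toℕ : (a : Fin n) → toℕ a mod n ≡ a
  mod-toℕ a = toℕ-injective (toℕ-mod (toℕ<n a))

  next : Fin n → Fin n
  next a = suc (toℕ a) mod n

  toℕ-next : ∀ a → (suc (toℕ a) < n × toℕ (next a) ≡ suc (toℕ a)) ⊎ (suc (toℕ a) ≡ n × toℕ (next a) ≡ 0)
  toℕ-next a with m≤n⇒m<n∨m≡n (toℕ<n a)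
  ... | inj₁ 1+a<n = inj₁ (1+a<n , toℕ-mod 1+a<n)
  ... | inj₂ 1+a≡n = inj₂ (1+a≡n , trans (cong (λ j → toℕ (j mod n)) 1+a≡n) toℕ-n-mod-n)

  next-injective : ∀ {a b} → next a ≡ next b → a ≡ b
  next-injective {a} {b} e with toℕ-next a | toℕ-next b
  ... | inj₁ (_ , ea) | inj₁ (_ , eb) = toℕ-injective (suc-injective (trans (sym ea) (trans (cong toℕ e) eb)))
  ... | inj₁ (_ , ea) | inj₂ (_ , eb) with () ← trans (sym ea) (trans (cong toℕ e) eb)
  ... | inj₂ (_ , ea) | inj₁ (_ , eb) with () ← trans (sym eb) (trans (cong toℕ (sym e)) ea)
  ... | inj₂ (wa , _) | inj₂ (wb , _) = toℕ-injective (suc-injective (trans wa (sym wb)))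

  next-of-suc : ∀ {a b} → toℕ b ≡ suc (toℕ a) → b ≡ next a
  next-of-suc {a} {b} e = trans (sym (mod-toℕ b)) (cong (λ j → j mod n) e)

  next-mod : ∀ {j} → j < n → next (j mod n) ≡ suc j mod n
  next-mod j<n = cong (λ t → suc t mod n) (toℕ-mod j<n)

  -- cycAdj n a b unfolds to Succ a b ∨ Succ b a.
  Succ : Fin n → Fin n → Bool
  Succ a b = (suc (toℕ a) ≡ᵇ toℕ b) ∨ ((suc (toℕ a) ≡ᵇ n) ∧ (toℕ b ≡ᵇ 0))

  Succ⇒next : ∀ {a b} → Succ a b ≡ true → b ≡ next a
  Succ⇒next {a} {b} e with ∨-true⁻ (suc (toℕ a) ≡ᵇ toℕ b) e
  ... | inj₁ 1+a≡b = next-of-suc (sym (≡ᵇ-true⁻ 1+a≡b))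
  ... | inj₂ wraps with ∧-true⁻ (suc (toℕ a) ≡ᵇ n) wraps
  ...   | 1+a≡n , b≡0 = toℕ-injective (trans (≡ᵇ-true⁻ b≡0)
                          (sym (trans (cong (λ j → toℕ (j mod n)) (≡ᵇ-true⁻ {suc (toℕ a)} {n} 1+a≡n)) toℕ-n-mod-n)))

  Succ-next : ∀ a → Succ a (next a) ≡ true
  Succ-next a with toℕ-next a
  ... | inj₁ (_ , e)     = ∨-trueˡ _ (≡ᵇ-true (sym e))
  ... | inj₂ (1+a≡n , e) = ∨-trueʳ (suc (toℕ a) ≡ᵇ toℕ (next a))
                               (∧-true (≡ᵇ-true {suc (toℕ a)} {n} 1+a≡n) (≡ᵇ-true {toℕ (next a)} {0} e))

  Adjacent : Fin n → Fin n → Set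
  Adjacent a b = b ≡ next a ⊎ a ≡ next b

  cycAdj⇒Adjacent : ∀ {a b} → cycAdj n a b ≡ true → Adjacent a b
  cycAdj⇒Adjacent {a} {b} e with ∨-true⁻ (Succ a b) e
  ... | inj₁ e = inj₁ (Succ⇒next e)
  ... | inj₂ e = inj₂ (Succ⇒next e)

  Adjacent⇒cycAdj : ∀ {a b} → Adjacent a b → cycAdj n a b ≡ true
  Adjacent⇒cycAdj {a} (inj₁ refl) = ∨-trueˡ _ (Succ-next a)
  Adjacent⇒cycAdj {b = b} (inj₂ refl) = ∨-trueʳ (Succ (next b) b) (Succ-next b)

  atMostTwoNeighbours : ∀ {a c p u} → Adjacent a u → Adjacent c u → Adjacent p u → a ≢ p → c ≢ p → a ≡ c
  atMostTwoNeighbours (inj₂ a) (inj₂ c) _ _ _ = trans a (sym c)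
  atMostTwoNeighbours (inj₁ a) (inj₁ c) _ _ _ = next-injective (trans (sym a) c)
  atMostTwoNeighbours (inj₁ a) (inj₂ c) (inj₁ p) a≢p _ = ⊥-elim (a≢p (next-injective (trans (sym a) p)))
  atMostTwoNeighbours (inj₁ a) (inj₂ c) (inj₂ p) _ c≢p = ⊥-elim (c≢p (trans c (sym p)))
  atMostTwoNeighbours (inj₂ a) (inj₁ c) (inj₁ p) _ c≢p = ⊥-elim (c≢p (next-injective (trans (sym c) p)))
  atMostTwoNeighbours (inj₂ a) (inj₁ c) (inj₂ p) a≢p _ = ⊥-elim (a≢p (trans a (sym p)))

module Product (m : ℕ) where
  open Cycle m public

  Adj : V n → V n → Set
  Adj (u' , v') (u , v) = (u' ≡ u × v' ≢ v) ⊎ (v' ≡ v × Adjacent u' u)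

  compAdj⇒≢ : ∀ {v' v : Fin n} → compAdj n v' v ≡ true → v' ≢ v
  compAdj⇒≢ {v = v} e refl with trans (sym e) (cong not (≡ᵇ-true {toℕ v} {toℕ v} refl))
  ... | ()

  ≢⇒compAdj : ∀ {v' v : Fin n} → v' ≢ v → compAdj n v' v ≡ true
  ≢⇒compAdj v'≢v = cong not (≡ᵇ-false (v'≢v ∘ toℕ-injective))

  prodAdj⇒Adj : ∀ {y x} → prodAdj n y x ≡ true → Adj y x
  prodAdj⇒Adj {u' , v'} {u , v} e with ∨-true⁻ (eqF u' u ∧ compAdj n v' v) e
  ... | inj₁ sameLayer with ∧-true⁻ (eqF u' u) sameLayer
  ...   | u'≡u , v'≢v = inj₁ (toℕ-injective (≡ᵇ-true⁻ u'≡u) , compAdj⇒≢ v'≢v)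
  prodAdj⇒Adj {u' , v'} {u , v} e | inj₂ sameColumn with ∧-true⁻ (eqF v' v) sameColumn
  ...   | v'≡v , u'~u = inj₂ (toℕ-injective (≡ᵇ-true⁻ v'≡v) , cycAdj⇒Adjacent u'~u)

  Adj⇒prodAdj : ∀ {y x} → Adj y x → prodAdj n y x ≡ true
  Adj⇒prodAdj {u , _} (inj₁ (refl , v'≢v)) = ∨-trueˡ _ (∧-true (≡ᵇ-true {toℕ u} refl) (≢⇒compAdj v'≢v))
  Adj⇒prodAdj {u' , v} {u , _} (inj₂ (refl , u'~u)) =
    ∨-trueʳ (eqF u' u ∧ compAdj n v v) (∧-true (≡ᵇ-true {toℕ v} refl) (Adjacent⇒cycAdj u'~u))

  ∈-allV : (x : V n) → x ∈ allV n
  ∈-allV (u , v) = ∈-cartesianProduct⁺ (∈-allFin u) (∈-allFin v)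

  allV-unique : Unique (allV n)
  allV-unique = cartesianProduct⁺ (allFin⁺ n) (allFin⁺ n)

  EarlierNeighbour : (V n → ℕ) → ℕ → V n → V n → Set
  EarlierNeighbour lvl k x y = Adj y x × lvl y < k

  earlierNbrs≤1 : ∀ {lvl k x} → (∀ {y z} → EarlierNeighbour lvl k x y → EarlierNeighbour lvl k x z → y ≡ z) →
                  earlierNbrs n lvl x k ≤ 1
  earlierNbrs≤1 {lvl} {k} {x} same = count≤1 _ allV-unique λ _ _ y∈ z∈ → same (fromBool y∈) (fromBool z∈)
    where
    fromBool : ∀ {y} → (prodAdj n y x ∧ (lvl y <ᵇ k)) ≡ true → EarlierNeighbour lvl k x y
    fromBool {y} e with ∧-true⁻ (prodAdj n y x) e
    ... | y~x , early = prodAdj⇒Adj y~x , <ᵇ-true⁻ early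

  earlierNbrs≥2 : ∀ {lvl k x y z} → y ≢ z → EarlierNeighbour lvl k x y → EarlierNeighbour lvl k x z →
                  2 ≤ earlierNbrs n lvl x k
  earlierNbrs≥2 {y = y} {z} y≢z (y~x , y<k) (z~x , z<k) =
    count≥2 _ y≢z (∈-allV y) (∈-allV z) (∧-true (Adj⇒prodAdj y~x) (<ᵇ-true y<k))
                                        (∧-true (Adj⇒prodAdj z~x) (<ᵇ-true z<k))

module LowerBound (m : ℕ) (D : V (suc (suc m)) → Bool) (monopoly : IsDynMonopoly (suc (suc m)) 2 D) where
  open Product (suc m)

  lvl : V n → ℕ
  lvl = proj₁ monopoly

  round0⇒seed : ∀ {x} → lvl x ≡ 0 → D x ≡ true
  round0⇒seed {x} = proj₂ (proj₁ (proj₂ monopoly) x)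

  threshold : ∀ {x i} → lvl x ≡ suc i → 2 ≤ earlierNbrs n lvl x (suc i)
  threshold {x} {i} = proj₂ (proj₂ monopoly) x i

  Earlier : ℕ → V n → V n → Set
  Earlier = EarlierNeighbour lvl

  no-unique-earlier : ∀ {x i} → lvl x ≡ suc i → ¬ (∀ {y z} → Earlier (suc i) x y → Earlier (suc i) x z → y ≡ z)
  no-unique-earlier l≡ same = 2≰1 (threshold l≡) (earlierNbrs≤1 same)

  seeds : Fin n → ℕ
  seeds u = count (λ v → D (u , v)) (allFin n)

  seeds≡0 : ∀ {u} → seeds u ≡ 0 → ∀ v → D (u , v) ≢ true
  seeds≡0 {u} s≡0 v seed with () ← subst (1 ≤_) s≡0 (count≥1 (λ v → D (u , v)) (∈-allFin v) seed)

  module SeedlessPair (u₀ : Fin n) (seedless₀ : ∀ v → D (u₀ , v) ≢ true) (seedless₁ : ∀ v → D (next u₀ , v) ≢ true)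
    where

    InPair : Fin n → Set
    InPair u = u ≡ u₀ ⊎ u ≡ next u₀

    seedless : ∀ {u} v → InPair u → D (u , v) ≢ true
    seedless v (inj₁ refl) = seedless₀ v
    seedless v (inj₂ refl) = seedless₁ v

    outsideNeighbour-unique : ∀ {u a c} → InPair u → Adjacent a u → Adjacent c u → ¬ InPair a → ¬ InPair c → a ≡ c
    outsideNeighbour-unique (inj₁ refl) a~u c~u a∉ c∉ = atMostTwoNeighbours a~u c~u (inj₂ refl) (a∉ ∘ inj₂) (c∉ ∘ inj₂)
    outsideNeighbour-unique (inj₂ refl) a~u c~u a∉ c∉ = atMostTwoNeighbours a~u c~u (inj₁ refl) (a∉ ∘ inj₁) (c∉ ∘ inj₁)

    not-infected-at : ∀ k → (∀ {u} v → InPair u → k ≤ lvl (u , v)) → ∀ {u} v → InPair u → lvl (u , v) ≢ k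
    not-infected-at zero    _     v u∈ l≡0 = seedless v u∈ (round0⇒seed l≡0)
    not-infected-at (suc i) later {u} v u∈ l≡ = no-unique-earlier l≡ same
      where
      outside : ∀ {a b} → lvl (a , b) < suc i → ¬ InPair a
      outside {b = b} l< a∈ = <⇒≱ l< (later b a∈)

      same : ∀ {y z} → Earlier (suc i) (u , v) y → Earlier (suc i) (u , v) z → y ≡ z
      same (inj₁ (refl , _) , l<) _ = ⊥-elim (outside l< u∈)
      same _ (inj₁ (refl , _) , l<) = ⊥-elim (outside l< u∈)
      same (inj₂ (refl , a~u) , la) (inj₂ (refl , c~u) , lc) =
        cong (_, v) (outsideNeighbour-unique u∈ a~u c~u (outside la) (outside lc))

    never-infected : ∀ k {u} v → InPair u → k ≤ lvl (u , v)
    never-infected zero    v u∈ = z≤n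
    never-infected (suc k) v u∈ with m≤n⇒m<n∨m≡n (never-infected k v u∈)
    ... | inj₁ k<l = k<l
    ... | inj₂ k≡l = ⊥-elim (not-infected-at k (never-infected k) v u∈ (sym k≡l))

    impossible : ⊥
    impossible = 1+n≰n (never-infected (suc (lvl (u₀ , fzero))) fzero (inj₁ refl))

  consecutive-layers-seeded : ∀ u → 1 ≤ seeds u + seeds (next u)
  consecutive-layers-seeded u = n≢0⇒n>0 λ s≡0 → SeedlessPair.impossible u
    (seeds≡0 (m+n≡0⇒m≡0 (seeds u) s≡0)) (seeds≡0 (m+n≡0⇒n≡0 (seeds u) s≡0))

  OnePerLayer : ℕ → Set
  OnePerLayer k = ∀ {u v w} → lvl (u , v) < k → lvl (u , w) < k → v ≡ w

  AlignedAlongCycle : ℕ → Set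
  AlignedAlongCycle k = ∀ {u u' v w} → Adjacent u u' → lvl (u , v) < k → lvl (u' , w) < k → v ≡ w

  Sparse : ℕ → Set
  Sparse k = OnePerLayer k × AlignedAlongCycle k

  -- A vertex infected while the infected set is sparse has no infected vertex in its layer, so it needs
  -- both of its cycle neighbours in its column; this keeps the set sparse.
  module SparseStep {i} (onePerLayer : OnePerLayer (suc i)) (aligned : AlignedAlongCycle (suc i)) where

    alone-in-layer : ∀ {u v w} → lvl (u , v) ≡ suc i → lvl (u , w) < suc i → ⊥
    alone-in-layer {u} {v} {w} l≡ lw = no-unique-earlier l≡ λ y z → trans (only y) (sym (only z))
      where
      only : ∀ {y} → Earlier (suc i) (u , v) y → y ≡ (u , w)
      only (inj₁ (refl , _) , lb) = cong (u ,_) (onePerLayer lb lw)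
      only (inj₂ (refl , a~u) , la) with aligned (swap a~u) lw la
      ... | refl = ⊥-elim (<-irrefl l≡ lw)

    cycleNeighbours-earlier : ∀ {u v u'} → lvl (u , v) ≡ suc i → Adjacent u' u → lvl (u' , v) < suc i
    cycleNeighbours-earlier {u} {v} {u'} l≡ u'~u with lvl (u' , v) <? suc i
    ... | yes l< = l<
    ... | no l≮ = ⊥-elim (no-unique-earlier l≡ same)
      where
      same : ∀ {y z} → Earlier (suc i) (u , v) y → Earlier (suc i) (u , v) z → y ≡ z
      same (inj₁ (refl , _) , lb) _ = ⊥-elim (alone-in-layer l≡ lb)
      same _ (inj₁ (refl , _) , lc) = ⊥-elim (alone-in-layer l≡ lc)
      same (inj₂ (refl , a~u) , la) (inj₂ (refl , c~u) , lc) =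
        cong (_, v) (atMostTwoNeighbours a~u c~u u'~u (λ { refl → l≮ la }) (λ { refl → l≮ lc }))

    sparse-next : Sparse (suc (suc i))
    sparse-next = onePerLayer′ , aligned′
      where
      onePerLayer′ : OnePerLayer (suc (suc i))
      onePerLayer′ lv lw with m<1+n⇒m<n∨m≡n lv | m<1+n⇒m<n∨m≡n lw
      ... | inj₁ v< | inj₁ w< = onePerLayer v< w<
      ... | inj₂ v≡ | inj₁ w< = ⊥-elim (alone-in-layer v≡ w<)
      ... | inj₁ v< | inj₂ w≡ = ⊥-elim (alone-in-layer w≡ v<)
      ... | inj₂ v≡ | inj₂ w≡ = onePerLayer (cycleNeighbours-earlier v≡ (inj₂ refl))
                                            (cycleNeighbours-earlier w≡ (inj₂ refl))

      aligned′ : AlignedAlongCycle (suc (suc i))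
      aligned′ u~u' lv lw with m<1+n⇒m<n∨m≡n lv | m<1+n⇒m<n∨m≡n lw
      ... | inj₁ v< | inj₁ w< = aligned u~u' v< w<
      ... | inj₂ v≡ | inj₁ w< = onePerLayer (cycleNeighbours-earlier v≡ (swap u~u')) w<
      ... | inj₁ v< | inj₂ w≡ = onePerLayer v< (cycleNeighbours-earlier w≡ u~u')
      ... | inj₂ v≡ | inj₂ w≡ = ⊥-elim (alone-in-layer v≡ (cycleNeighbours-earlier w≡ u~u'))

  Thin : Set
  Thin = ∀ u → seeds u + seeds (next u) ≤ 1

  seeded : ∀ {x} → lvl x < 1 → D x ≡ true
  seeded l<1 = round0⇒seed (n<1⇒n≡0 l<1)

  sparse-initially : Thin → Sparse 1
  sparse-initially thin = onePerLayer , aligned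
    where
    onePerLayer : OnePerLayer 1
    onePerLayer {u} {v} {w} lv lw with v ≟ᶠ w
    ... | yes v≡w = v≡w
    ... | no v≢w = ⊥-elim (2≰1 (≤-trans (count≥2 (λ v → D (u , v)) v≢w (∈-allFin v) (∈-allFin w)
                                                   (seeded lv) (seeded lw))
                                         (m≤m+n (seeds u) _))
                               (thin u))

    two-seeds : ∀ {u v w} → lvl (u , v) < 1 → lvl (next u , w) < 1 → ⊥
    two-seeds {u} lv lw = 2≰1 (+-mono-≤ (count≥1 (λ v → D (u , v)) (∈-allFin _) (seeded lv))
                                         (count≥1 (λ w → D (next u , w)) (∈-allFin _) (seeded lw)))
                               (thin u)

    aligned : AlignedAlongCycle 1
    aligned (inj₁ refl) lv lw = ⊥-elim (two-seeds lv lw)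
    aligned (inj₂ refl) lv lw = ⊥-elim (two-seeds lw lv)

  sparse-always : Thin → ∀ i → Sparse (suc i)
  sparse-always thin zero    = sparse-initially thin
  sparse-always thin (suc i) = SparseStep.sparse-next (proj₁ (sparse-always thin i)) (proj₂ (sparse-always thin i))

  not-thin : ¬ Thin
  not-thin thin with proj₁ (sparse-always thin (lvl (fzero , fzero) + lvl (fzero , fsuc fzero)))
                      (s≤s (m≤m+n _ _)) (s≤s (m≤n+m _ _))
  ... | ()

  some-consecutive-layers-seeded-twice : ∃ λ u → 2 ≤ seeds u + seeds (next u)
  some-consecutive-layers-seeded-twice with ¬∀⟶∃¬ n _ (λ u → seeds u + seeds (next u) ≤? 1) not-thin
  ... | u , ≰1 = u , ≰⇒> ≰1

  size≡sum-seeds : size n D ≡ ∑[ j < n ] seeds (j mod n)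
  size≡sum-seeds = trans (count-cartesianProduct D (allFin n) (allFin n))
                         (sum-map-allFin seeds (λ j → seeds (j mod n)) λ u → cong seeds (mod-toℕ u))

  n<size+size : n < size n D + size n D
  n<size+size with some-consecutive-layers-seeded-twice
  ... | u , two = begin-strict
    n                                               <⟨ k<sumBelow n pair (toℕ u) pos (toℕ<n u) two′ ⟩
    ∑[ j < n ] pair j                               ≡⟨ sumBelow-+ n e (e ∘ suc) ⟩
    ∑[ j < n ] e j + ∑[ j < n ] e (suc j)           ≡⟨ cong (∑[ j < n ] e j +_) (sumBelow-rotate n e (cong seeds n-mod-n)) ⟩
    ∑[ j < n ] e j + ∑[ j < n ] e j                 ≡⟨ sym (cong₂ _+_ size≡sum-seeds size≡sum-seeds) ⟩
    size n D + size n D                             ∎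
    where
    open ≤-Reasoning
    e : ℕ → ℕ
    e j = seeds (j mod n)
    pair : ℕ → ℕ
    pair j = e j + e (suc j)
    pos : ∀ j → j < n → 1 ≤ pair j
    pos j j<n = subst (λ a → 1 ≤ e j + seeds a) (next-mod j<n) (consecutive-layers-seeded (j mod n))
    two′ : 2 ≤ pair (toℕ u)
    two′ = subst (λ a → 2 ≤ seeds a + seeds (next u)) (sym (mod-toℕ u)) two

-- Round 1 infects (0,0); round 2 the rest of layer 0 and every
-- (u,0) with u even, whose cycle neighbours in column 0 are seeds or (0,0); layer u ≥ 1 is then
-- completed in round u + 3 from (u,0) and layer u − 1.
seed : ℕ → ℕ → Bool
seed zero    (suc zero) = true
seed (suc u) zero       = odd (suc u)
seed _       _          = false

round : ℕ → ℕ → ℕ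
round zero    zero          = 1
round zero    (suc zero)    = 0
round zero    (suc (suc _)) = 2
round (suc u) zero          = if odd (suc u) then 0 else 2
round (suc u) (suc _)       = 4 + u

seed⇔round0 : ∀ u v → (seed u v ≡ true → round u v ≡ 0) × (round u v ≡ 0 → seed u v ≡ true)
seed⇔round0 zero    zero          = (λ ()) , (λ ())
seed⇔round0 zero    (suc zero)    = (λ _ → refl) , (λ _ → refl)
seed⇔round0 zero    (suc (suc _)) = (λ ()) , (λ ())
seed⇔round0 (suc u) zero with odd (suc u)
... | true  = (λ _ → refl) , (λ _ → refl)
... | false = (λ ()) , (λ ())
seed⇔round0 (suc u) (suc _)       = (λ ()) , (λ ())

round-odd : ∀ {u} → odd u ≡ true → round u 0 ≡ 0
round-odd {suc u} odd-u rewrite odd-u = refl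

round-column0 : ∀ u → round u 0 ≤ 2
round-column0 zero = s≤s z≤n
round-column0 (suc u) with odd (suc u)
... | true  = z≤n
... | false = ≤-refl

round-layer : ∀ u v → round u (suc v) < 4 + u
round-layer zero    zero    = s≤s z≤n
round-layer zero    (suc v) = s≤s (s≤s (s≤s z≤n))
round-layer (suc u) v       = ≤-refl

layerSeeds : ℕ → ℕ
layerSeeds zero    = 1
layerSeeds (suc u) = indicator (odd (suc u))

module UpperBound (k : ℕ) where
  open Product (suc (suc k))

  D₀ : V n → Bool
  D₀ (u , v) = seed (toℕ u) (toℕ v)

  lvl₀ : V n → ℕ
  lvl₀ (u , v) = round (toℕ u) (toℕ v)

  previous-layer : ∀ u {v} → Adj (inject₁ u , v) (fsuc u , v)
  previous-layer u = inj₂ (refl , inj₁ (next-of-suc (cong suc (sym (toℕ-inject₁ u)))))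

  round-inject₁ : ∀ (u : Fin (suc (suc k))) v → round (toℕ (inject₁ u)) v ≡ round (toℕ u) v
  round-inject₁ u v = cong (λ j → round j v) (toℕ-inject₁ u)

  two-earlier : ∀ x r y z → y ≢ z → Adj y x → lvl₀ y < r → Adj z x → lvl₀ z < r → 2 ≤ earlierNbrs n lvl₀ x r
  two-earlier _ _ _ _ y≢z y~x y< z~x z< = earlierNbrs≥2 y≢z (y~x , y<) (z~x , z<)

  threshold : (x : V n) (i : ℕ) → lvl₀ x ≡ suc i → 2 ≤ earlierNbrs n lvl₀ x (suc i)
  threshold x@(fzero , fzero) _ refl =
    two-earlier x 1 (fzero , fsuc fzero) (fsuc fzero , fzero) (λ ())
      (inj₁ (refl , λ ())) (s≤s z≤n)
      (inj₂ (refl , inj₂ (next-of-suc refl))) (s≤s z≤n)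
  threshold x@(fzero , fsuc (fsuc v)) _ refl =
    two-earlier x 2 (fzero , fzero) (fzero , fsuc fzero) (λ ())
      (inj₁ (refl , λ ())) (s≤s (s≤s z≤n))
      (inj₁ (refl , λ ())) (s≤s z≤n)
  threshold x@(fsuc u , fsuc v) _ refl =
    two-earlier x (4 + toℕ u) (fsuc u , fzero) (inject₁ u , fsuc v) (λ ())
      (inj₁ (refl , λ ())) (s≤s (≤-trans (round-column0 (suc (toℕ u))) (s≤s (s≤s z≤n))))
      (previous-layer u) (subst (_< 4 + toℕ u) (sym (round-inject₁ u (suc (toℕ v)))) (round-layer (toℕ u) (toℕ v)))
  threshold x@(fsuc u , fzero) i l≡ with odd (suc (toℕ u)) in even-1+u
  ... | true  with () ← l≡
  ... | false with refl ← l≡ =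
    two-earlier x 2 (inject₁ u , fzero) (next (fsuc u) , fzero) distinct
      (previous-layer u) (subst (_< 2) (sym (trans (round-inject₁ u 0) (round-odd {toℕ u} odd-u))) (s≤s z≤n))
      (inj₂ (refl , inj₂ refl)) (s≤s following)
    where
    odd-u : odd (toℕ u) ≡ true
    odd-u = odd-suc≡false⇒odd (toℕ u) even-1+u

    following : round (toℕ (next (fsuc u))) 0 ≤ 1
    following with toℕ-next (fsuc u)
    ... | inj₁ (_ , e) rewrite e | odd-u = z≤n
    ... | inj₂ (_ , e) rewrite e = ≤-refl

    distinct : (inject₁ u , fzero) ≢ (next (fsuc u) , fzero)
    distinct eq with toℕ-next (fsuc u) | trans (sym (toℕ-inject₁ u)) (cong (toℕ ∘ proj₁) eq)
    ... | inj₁ (_ , e) | u≡ = <-irrefl (trans u≡ e) (<-trans (n<1+n (toℕ u)) (n<1+n (suc (toℕ u))))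
    ... | inj₂ (_ , e) | u≡ with () ← subst (λ j → odd j ≡ true) (trans u≡ e) odd-u

  monopoly : IsDynMonopoly n 2 D₀
  monopoly = lvl₀ , (λ (u , v) → seed⇔round0 (toℕ u) (toℕ v)) , threshold

  seeds-in-layer : ∀ u → ∑[ v < n ] indicator (seed u v) ≡ layerSeeds u
  seeds-in-layer zero    = cong suc (sumBelow-≡0 (suc k) _ λ _ → refl)
  seeds-in-layer (suc u) = trans (cong (indicator (odd (suc u)) +_) (sumBelow-≡0 (suc (suc k)) _ λ _ → refl))
                                 (+-identityʳ _)

  size-D₀ : size n D₀ ≡ (n + 2) / 2
  size-D₀ = begin
    size n D₀
      ≡⟨ count-cartesianProduct D₀ (allFin n) (allFin n) ⟩
    sum (map (λ u → count (λ v → D₀ (u , v)) (allFin n)) (allFin n))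
      ≡⟨ sum-map-allFin {n} _ layerSeeds (λ u → sym (trans (count-allFin n (seed (toℕ u))) (seeds-in-layer (toℕ u)))) ⟩
    ∑[ u < n ] layerSeeds u ≡⟨ cong suc (sumBelow-odd n) ⟩
    suc (n / 2)             ≡⟨ sym ([2+k]/2≡1+k/2 n) ⟩
    (2 + n) / 2             ≡⟨ cong (_/ 2) (+-comm 2 n) ⟩
    (n + 2) / 2             ∎
    where open ≡-Reasoning

theorem6 : (n : ℕ) → 3 ≤ n → DynEq n 2 ((n + 2) / 2)
theorem6 (suc (suc (suc k))) (s≤s (s≤s (s≤s _))) =
  (D₀ , monopoly , size-D₀) , λ D monopolyᴰ → [n+2]/2≤ _ _ (LowerBound.n<size+size (suc k) D monopolyᴰ)
  where open UpperBound k
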